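{- Let $n\ge 2$. Let $B_{c\ge d}$ be the set of unit cubes of block $B$ whose location labels $(a,b,c,d)$ satisfy $c\ge d$, and let $A_{a<b}$ be the set of unit cubes of block $A$ whose location labels satisfy $a<b$. Then $B_{c\ge d}$ and $A_{a<b}$ are disjoint as sets of unit cubes, and their union is the set of unit cubes in the region $R_3(n)$ whose location labels $(a,b,c,d)$ satisfy both $1\le a<b\le n+1$ and $1\le d\le c\le n$. The number of unit cubes in this union is $\binom{n+1}{2}^2$.
   Context: Coordinates on $\mathbb{R}^4$ are $(x,y,z,w)$. For integers $a,b,c,d$, the unit cube (or unit cube sized location) with location label $(a,b,c,d)$ is $\{(x,y,z,w): a-1\le x\le a,\ b-1\le y\le b,\ c-1\le z\le c,\ d-1\le w\le d\}$. For fixed $n\ge 2$, block $A$ is the union of the unit cubes with labels in $\{(x,y,z,w): 1\le i\le n,\ z=i,\ x,y,w\in\{1,\dots,i\}\}$; block $B$ is the union of the unit cubes with labels in $\{(x,y,z,w): 1\le i\le n,\ y=i+1,\ x,z,w\in\{1,\dots,i\}\}$. The region $R_3(n)$ is the union of the unit cube sized locations with labels satisfying $x,y\in\{1,\dots,n+1\}$ and $z,w\in\{1,\dots,n\}$. -}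

module Defs where

open import Data.Nat using (ℕ; suc; _≤_; _<_)
open import Data.Product using (_×_; _,_; ∃-syntax)
open import Data.Sum using (_⊎_)

-- A location label (a , b , c , d) ∈ ℤ⁴; all labels involved are ≥ 1, so ℕ⁴ suffices.
-- A unit cube (sized location) is identified with its label; a set of unit cubes
-- is a predicate on labels.
Label : Set
Label = ℕ × ℕ × ℕ × ℕ

InA : ℕ → Label → Set
InA n (x , y , z , w) =
  ∃[ i ] ((1 ≤ i × i ≤ n) × z ≡ i
         × (1 ≤ x × x ≤ i) × (1 ≤ y × y ≤ i) × (1 ≤ w × w ≤ i))
  where open import Relation.Binary.PropositionalEquality using (_≡_)

InB : ℕ → Label → Set
InB n (x , y , z , w) =
  ∃[ i ] ((1 ≤ i × i ≤ n) × y ≡ suc i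
         × (1 ≤ x × x ≤ i) × (1 ≤ z × z ≤ i) × (1 ≤ w × w ≤ i))
  where open import Relation.Binary.PropositionalEquality using (_≡_)

InR3 : ℕ → Label → Set
InR3 n (x , y , z , w) =
  (1 ≤ x × x ≤ suc n) × (1 ≤ y × y ≤ suc n) × (1 ≤ z × z ≤ n) × (1 ≤ w × w ≤ n)

InBcd : ℕ → Label → Set
InBcd n l@(a , b , c , d) = InB n l × d ≤ c

InAab : ℕ → Label → Set
InAab n l@(a , b , c , d) = InA n l × a < b

InTarget : ℕ → Label → Set
InTarget n l@(a , b , c , d) =
  InR3 n l × (1 ≤ a × a < b × b ≤ suc n) × (1 ≤ d × d ≤ c × c ≤ n)

{-# OPTIONS --safe #-}
module Submission where

-- A target cube (a , b , c , d) is the same as two independent sorted pairs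
-- 1 ≤ a ≤ b-1 ≤ n and 1 ≤ d ≤ c ≤ n, each of which ranges over C(n+1,2) values.
-- Such a cube lies in A (at level i = c) exactly when b ≤ c, and in B (at level
-- i = b-1) exactly when c < b, so A_{a<b} and B_{c≥d} split the target.

open import Defs
open import Level using (Level)
open import Data.Nat using (ℕ; zero; suc; _≤_; _<_; _+_; _*_; _^_; z≤n; s≤s; _≤?_)
open import Data.Nat.Properties
open import Data.Nat.Combinatorics using (_C_; nC1≡n; nCk+nC[k+1]≡[n+1]C[k+1])
open import Data.Product using (_×_; _,_; proj₁; ∃-syntax)
open import Data.Sum using (_⊎_; inj₁; inj₂; [_,_])
open import Data.Empty using (⊥)
open import Data.List using (List; []; _∷_; _++_; length; map; applyUpTo; cartesianProductWith)
open import Data.List.Properties using (length-++; length-map; length-applyUpTo)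
open import Data.List.Membership.Propositional using (_∈_)
open import Data.List.Membership.Propositional.Properties
  using (∈-++⁺ˡ; ∈-++⁺ʳ; ∈-++⁻; ∈-applyUpTo⁺; ∈-applyUpTo⁻; ∈-cartesianProductWith⁺; ∈-cartesianProductWith⁻)
open import Data.List.Relation.Unary.Unique.Propositional using (Unique; [])
import Data.List.Relation.Unary.Unique.Propositional.Properties as Unique
open import Function.Bundles using (_⇔_; mk⇔)
import Function.Properties.Equivalence as ⇔
open import Relation.Binary.PropositionalEquality using (_≡_; refl; cong; cong₂; sym; module ≡-Reasoning)
open import Relation.Nullary using (yes; no)

private
  variable
    a b c : Level
    X : Set a
    Y : Set b
    Z : Set c

length-cartesianProductWith : (f : X → Y → Z) (xs : List X) (ys : List Y) →
  length (cartesianProductWith f xs ys) ≡ length xs * length ys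
length-cartesianProductWith f []       ys = refl
length-cartesianProductWith f (x ∷ xs) ys = begin
  length (map (f x) ys ++ cartesianProductWith f xs ys)      ≡⟨ length-++ (map (f x) ys) ⟩
  length (map (f x) ys) + length (cartesianProductWith f xs ys)
    ≡⟨ cong₂ _+_ (length-map (f x) ys) (length-cartesianProductWith f xs ys) ⟩
  length ys + length xs * length ys                          ∎
  where open ≡-Reasoning

SortedPair : ℕ → ℕ × ℕ → Set
SortedPair k (x , y) = 1 ≤ x × x ≤ y × y ≤ k

column : ℕ → List (ℕ × ℕ)
column k = applyUpTo (λ i → suc i , k) k

sortedPairs : ℕ → List (ℕ × ℕ)
sortedPairs zero    = []
sortedPairs (suc k) = sortedPairs k ++ column (suc k)

∈-column⁺ : ∀ {k x} → 1 ≤ x → x ≤ k → (x , k) ∈ column k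
∈-column⁺ {k} {suc i} _ i<k = ∈-applyUpTo⁺ (λ i → suc i , k) i<k

∈-column⁻ : ∀ {k x y} → (x , y) ∈ column k → 1 ≤ x × x ≤ k × y ≡ k
∈-column⁻ {k} p with _ , i<k , refl ← ∈-applyUpTo⁻ (λ i → suc i , k) p = s≤s z≤n , i<k , refl

column-unique : ∀ k → Unique (column k)
column-unique k = Unique.applyUpTo⁺₁ _ k
  (λ i<j _ eq → <⇒≢ i<j (suc-injective (cong proj₁ eq)))

∈-sortedPairs⁺ : ∀ {k p} → SortedPair k p → p ∈ sortedPairs k
∈-sortedPairs⁺ {zero}  (s≤s _ , s≤s _ , ())
∈-sortedPairs⁺ {suc k} (1≤x , x≤y , y≤1+k) with m≤n⇒m<n∨m≡n y≤1+k
... | inj₁ (s≤s y≤k) = ∈-++⁺ˡ (∈-sortedPairs⁺ (1≤x , x≤y , y≤k))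
... | inj₂ refl      = ∈-++⁺ʳ (sortedPairs k) (∈-column⁺ 1≤x x≤y)

∈-sortedPairs⁻ : ∀ {k p} → p ∈ sortedPairs k → SortedPair k p
∈-sortedPairs⁻ {suc k} p with ∈-++⁻ (sortedPairs k) p
... | inj₁ q = let 1≤x , x≤y , y≤k = ∈-sortedPairs⁻ q in 1≤x , x≤y , m≤n⇒m≤1+n y≤k
... | inj₂ q with 1≤x , x≤y , refl ← ∈-column⁻ q = 1≤x , x≤y , ≤-refl

sortedPairs-unique : ∀ k → Unique (sortedPairs k)
sortedPairs-unique zero    = []
sortedPairs-unique (suc k) =
  Unique.++⁺ (sortedPairs-unique k) (column-unique (suc k)) λ { {_ , _} (p , q) →
    let _ , _ , y≤k = ∈-sortedPairs⁻ p ; _ , _ , y≡1+k = ∈-column⁻ q in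
    <-irrefl y≡1+k (s≤s y≤k) }

length-sortedPairs : ∀ k → length (sortedPairs k) ≡ suc k C 2
length-sortedPairs zero    = refl
length-sortedPairs (suc k) = begin
  length (sortedPairs k ++ column (suc k))          ≡⟨ length-++ (sortedPairs k) ⟩
  length (sortedPairs k) + length (column (suc k))
    ≡⟨ cong₂ _+_ (length-sortedPairs k) (length-applyUpTo (λ i → suc i , suc k) (suc k)) ⟩
  suc k C 2 + suc k                                 ≡⟨ cong (suc k C 2 +_) (sym (nC1≡n (suc k))) ⟩
  suc k C 2 + suc k C 1                             ≡⟨ +-comm (suc k C 2) (suc k C 1) ⟩
  suc k C 1 + suc k C 2                             ≡⟨ nCk+nC[k+1]≡[n+1]C[k+1] (suc k) 1 ⟩
  suc (suc k) C 2                                   ∎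
  where open ≡-Reasoning

label : ℕ × ℕ → ℕ × ℕ → Label
label (a , y) (d , c) = a , suc y , c , d

label-injective : ∀ {p p′ q q′} → label p q ≡ label p′ q′ → p ≡ p′ × q ≡ q′
label-injective {_ , _} {_ , _} {_ , _} {_ , _} refl = refl , refl

inTarget : ∀ {n a b c d} → 1 ≤ a → a < b → b ≤ suc n → 1 ≤ d → d ≤ c → c ≤ n →
  InTarget n (a , b , c , d)
inTarget 1≤a a<b b≤1+n 1≤d d≤c c≤n =
  ( (1≤a , ≤-trans (<⇒≤ a<b) b≤1+n) , (≤-trans (s≤s z≤n) a<b , b≤1+n)
  , (≤-trans 1≤d d≤c , c≤n) , (1≤d , ≤-trans d≤c c≤n) )
  , (1≤a , a<b , b≤1+n) , (1≤d , d≤c , c≤n)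

targets : ℕ → List Label
targets n = cartesianProductWith label (sortedPairs n) (sortedPairs n)

∈-targets⇔ : ∀ n l → l ∈ targets n ⇔ InTarget n l
∈-targets⇔ n l = mk⇔ to from
  where
  to : l ∈ targets n → InTarget n l
  to p with _ , _ , p∈ , q∈ , refl ← ∈-cartesianProductWith⁻ label (sortedPairs n) (sortedPairs n) p =
    let 1≤a , a≤y , y≤n = ∈-sortedPairs⁻ p∈ ; 1≤d , d≤c , c≤n = ∈-sortedPairs⁻ q∈ in
    inTarget 1≤a (s≤s a≤y) (s≤s y≤n) 1≤d d≤c c≤n
  from : InTarget n l → l ∈ targets n
  from (_ , (1≤a , s≤s a≤y , s≤s y≤n) , (1≤d , d≤c , c≤n)) =
    ∈-cartesianProductWith⁺ label (∈-sortedPairs⁺ (1≤a , a≤y , y≤n)) (∈-sortedPairs⁺ (1≤d , d≤c , c≤n))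

targets-unique : ∀ n → Unique (targets n)
targets-unique n = Unique.cartesianProductWith⁺ label label-injective (sortedPairs-unique n) (sortedPairs-unique n)

length-targets : ∀ n → length (targets n) ≡ (suc n C 2) ^ 2
length-targets n = begin
  length (targets n)                                  ≡⟨ length-cartesianProductWith label (sortedPairs n) (sortedPairs n) ⟩
  length (sortedPairs n) * length (sortedPairs n)     ≡⟨ cong₂ _*_ (length-sortedPairs n) (length-sortedPairs n) ⟩
  (suc n C 2) * (suc n C 2)                           ≡⟨ cong ((suc n C 2) *_) (sym (*-identityʳ (suc n C 2))) ⟩
  (suc n C 2) ^ 2                                     ∎
  where open ≡-Reasoning

Bcd-Aab-disjoint : ∀ n l → InBcd n l → InAab n l → ⊥
Bcd-Aab-disjoint n (a , b , c , d) ((_ , _ , refl , _ , (_ , c≤i) , _) , _) ((_ , _ , refl , _ , (_ , b≤j) , _) , _) =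
  <-irrefl refl (≤-trans b≤j c≤i)

Bcd⇒target : ∀ n l → InBcd n l → InTarget n l
Bcd⇒target n (a , b , c , d) ((i , (_ , i≤n) , refl , (1≤a , a≤i) , (_ , c≤i) , (1≤d , _)) , d≤c) =
  inTarget 1≤a (s≤s a≤i) (s≤s i≤n) 1≤d d≤c (≤-trans c≤i i≤n)

Aab⇒target : ∀ n l → InAab n l → InTarget n l
Aab⇒target n (a , b , c , d) ((i , (_ , i≤n) , refl , (1≤a , _) , (_ , b≤i) , (1≤d , d≤i)) , a<b) =
  inTarget 1≤a a<b (m≤n⇒m≤1+n (≤-trans b≤i i≤n)) 1≤d d≤i i≤n

target⇒Bcd⊎Aab : ∀ n l → InTarget n l → InBcd n l ⊎ InAab n l
target⇒Bcd⊎Aab n (a , suc y , c , d) (_ , (1≤a , s≤s a≤y , s≤s y≤n) , (1≤d , d≤c , c≤n)) with suc y ≤? c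
... | yes b≤c = inj₂
  ( (c , (≤-trans 1≤d d≤c , c≤n) , refl , (1≤a , ≤-trans (m≤n⇒m≤1+n a≤y) b≤c) , (s≤s z≤n , b≤c) , (1≤d , d≤c))
  , s≤s a≤y )
... | no b≰c = let c≤y = ≤-pred (≰⇒> b≰c) in inj₁
  ( (y , (≤-trans 1≤a a≤y , y≤n) , refl , (1≤a , a≤y) , (≤-trans 1≤d d≤c , c≤y) , (1≤d , ≤-trans d≤c c≤y))
  , d≤c )

Bcd⊎Aab⇔target : ∀ n l → (InBcd n l ⊎ InAab n l) ⇔ InTarget n l
Bcd⊎Aab⇔target n l = mk⇔ [ Bcd⇒target n l , Aab⇒target n l ] (target⇒Bcd⊎Aab n l)

lemma14 : (n : ℕ) → 2 ≤ n →
    ((l : Label) → InBcd n l → InAab n l → ⊥)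
    × ((l : Label) → (InBcd n l ⊎ InAab n l) ⇔ InTarget n l)
    × (∃[ L ] (Unique L
               × ((l : Label) → l ∈ L ⇔ (InBcd n l ⊎ InAab n l))
               × length L ≡ (suc n C 2) ^ 2))
lemma14 n _ =
    Bcd-Aab-disjoint n
  , Bcd⊎Aab⇔target n
  , targets n
  , targets-unique n
  , (λ l → ⇔.trans (∈-targets⇔ n l) (⇔.sym (Bcd⊎Aab⇔target n l)))
  , length-targets n
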